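{- Let $n\geq 1$, $n^*=\lceil n/2\rceil$, and let $1\leq k_1\leq n^*\leq k_2\leq n$. Let $C\subseteq A,B,D$ be subsets of a fixed metric space with distances in $\{0,\ldots,n\}$. Suppose $A\cup D$ and $B\cup D$ are freely amalgamated over $D$, and that each of $A$ and $B$ has distance $\geq k_1$ and $\leq k_2$ from $D$ over $C$. Then $A$ has distance $\geq\min(n^*,2k_1)$ and $\leq\max(k_2-k_1,n^*)$ from $B$ over $C$, and $D$ has distance $\geq k_1$ and $\leq k_2$ from $A\cup B$ over $C$.
   Context: Let $d$ be the metric. For subsets $X,Y$ with $C\subseteq X,Y$ and $x\in X\setminus C$, $y\in Y\setminus C$, put $m_{xy}=\min_{c\in C}(d(x,c)+d(y,c))$ and $m^{xy}=\max_{c\in C}|d(x,c)-d(y,c)|$. Let $C'\subseteq X, Y$ with $X\cap Y=C'$. $X$ and $Y$ are freely amalgamated over $C'$ if for all $x\in X\setminus C'$, $y\in Y\setminus C'$ (with $m$'s computed over $C'$): $d(x,y)=m_{xy}$ if $m_{xy}<n^*$; $d(x,y)=m^{xy}$ if $m^{xy}>n^*$; and $d(x,y)=n^*$ otherwise. For $X\cap Y=C$: $X$ and $Y$ have distance $\leq k$ over $C$ (where $k\leq n$) if $d(x,y)\leq\max(k,m^{xy})$ for all $x\in X\setminus C$, $y\in Y\setminus C$; they have distance $\geq k$ over $C$ (where $k\geq 1$) if $d(x,y)\geq\min(k,m_{xy})$ for all such $x,y$. -}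

module Defs where

open import Data.Nat using (ℕ; zero; suc; _+_; _≤_; _<_; _⊔_; _⊓_; ⌈_/2⌉; ∣_-_∣)
open import Data.Maybe using (Maybe; just; nothing)
open import Data.List using (List; []; _∷_)
open import Data.List.Membership.Propositional using (_∈_; _∉_)
open import Data.Product using (_×_)
open import Data.Empty using (⊥)
open import Relation.Nullary using (¬_)
open import Relation.Binary.PropositionalEquality using (_≡_)

record MetricSpace (n : ℕ) : Set₁ where
  field
    Carrier  : Set
    d        : Carrier → Carrier → ℕ
    d-bound  : ∀ x y → d x y ≤ n
    d-refl   : ∀ x → d x x ≡ 0
    d-eq     : ∀ x y → d x y ≡ 0 → x ≡ y
    d-sym    : ∀ x y → d x y ≡ d y x
    d-tri    : ∀ x y z → d x z ≤ d x y + d y z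

nStar : ℕ → ℕ
nStar n = ⌈ n /2⌉

-- minimum with ∞ represented by nothing
minM : ℕ → Maybe ℕ → Maybe ℕ
minM a nothing  = just a
minM a (just b) = just (a ⊓ b)

minInf : ℕ → Maybe ℕ → ℕ
minInf k nothing  = k
minInf k (just m) = k ⊓ m

BelowInf : Maybe ℕ → ℕ → Set
BelowInf nothing  k = ⊥
BelowInf (just m) k = m < k

module _ {n : ℕ} (M : MetricSpace n) where
  open MetricSpace M

  Subset : Set
  Subset = List Carrier

  InterEq : Subset → Subset → Subset → Set
  InterEq X Y C = ∀ z → ((z ∈ X × z ∈ Y) → z ∈ C) × (z ∈ C → (z ∈ X × z ∈ Y))

  -- m_{xy} = min_{c∈C} (d(x,c)+d(y,c)); min over ∅ is ∞ (nothing)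
  mLow : Carrier → Carrier → Subset → Maybe ℕ
  mLow x y []      = nothing
  mLow x y (c ∷ C) = minM (d x c + d y c) (mLow x y C)

  -- m^{xy} = max_{c∈C} |d(x,c)-d(y,c)|; max over ∅ is 0
  mUp : Carrier → Carrier → Subset → ℕ
  mUp x y []      = 0
  mUp x y (c ∷ C) = ∣ d x c - d y c ∣ ⊔ mUp x y C

  FreelyAmalgamated : Subset → Subset → Subset → Set
  FreelyAmalgamated X Y C' =
    InterEq X Y C' ×
    (∀ x y → x ∈ X → x ∉ C' → y ∈ Y → y ∉ C' →
       (∀ m → mLow x y C' ≡ just m → m < nStar n → d x y ≡ m) ×
       (nStar n < mUp x y C' → d x y ≡ mUp x y C') ×
       (¬ BelowInf (mLow x y C') (nStar n) → ¬ (nStar n < mUp x y C') → d x y ≡ nStar n))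

  DistLe : Subset → Subset → Subset → ℕ → Set
  DistLe X Y C k =
    InterEq X Y C ×
    (∀ x y → x ∈ X → x ∉ C → y ∈ Y → y ∉ C → d x y ≤ k ⊔ mUp x y C)

  DistGe : Subset → Subset → Subset → ℕ → Set
  DistGe X Y C k =
    InterEq X Y C ×
    (∀ x y → x ∈ X → x ∉ C → y ∈ Y → y ∉ C → minInf k (mLow x y C) ≤ d x y)

module Submission where

-- Take x ∈ A ∖ C and y ∈ B ∖ C. Free amalgamation over D makes d(x,y) either
-- d(x,e) + d(y,e) < n* or |d(x,e) − d(y,e)| > n* for some e ∈ D, or n*. For e ∈ C
-- both quantities are controlled by m_{xy}, m^{xy} over C directly. For e ∈ D ∖ C the
-- hypotheses give d(x,e), d(y,e) ≥ k₁ unless some c ∈ C lies between the point and e,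
-- in which case the path through e is no shorter than the path through c; this yields
-- the lower bound min(n*, 2k₁). Symmetrically d(x,e) ≤ k₂ unless some c ∈ C sees x and e
-- at very different distances, and together with d(y,e) ≥ k₁ this bounds
-- |d(x,e) − d(y,e)| by max(k₂ − k₁, m^{xy}). The statement about D and A ∪ B is a
-- pointwise union of the hypotheses.

open import Defs
open import Data.Nat using (ℕ; _+_; _≤_; _<_; _*_; _∸_; _⊔_; _⊓_; ∣_-_∣; z≤n; _≟_; _<?_)
open import Data.Nat.Properties
open import Data.Maybe using (just; nothing)
open import Data.Maybe.Properties using (just-injective)
open import Data.List using ([]; _∷_; _++_)
open import Data.List.Relation.Unary.All using (All)
import Data.List.Relation.Unary.All as All
open import Data.List.Relation.Unary.Any using (here; there)
open import Data.List.Membership.Propositional using (_∈_; _∉_)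
open import Data.List.Membership.Propositional.Properties using (∈-++⁺ˡ; ∈-++⁻)
open import Data.Product using (_×_; _,_; proj₁; proj₂; ∃-syntax; swap)
open import Data.Sum using (_⊎_; inj₁; inj₂; [_,_])
open import Relation.Nullary using (¬_; yes; no; contradiction)
open import Relation.Binary.Definitions using (DecidableEquality)
open import Relation.Binary.PropositionalEquality using (_≡_; refl; sym; trans; cong; cong₂; subst; subst₂)

m⊓n≤o⇒m≤o⊎n≤o : ∀ m n {o} → m ⊓ n ≤ o → m ≤ o ⊎ n ≤ o
m⊓n≤o⇒m≤o⊎n≤o m n {o} h with ⊓-sel m n
... | inj₁ eq = inj₁ (subst (_≤ o) eq h)
... | inj₂ eq = inj₂ (subst (_≤ o) eq h)

o≤m⊔n⇒o≤m⊎o≤n : ∀ m n {o} → o ≤ m ⊔ n → o ≤ m ⊎ o ≤ n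
o≤m⊔n⇒o≤m⊎o≤n m n {o} h with ⊔-sel m n
... | inj₁ eq = inj₁ (subst (o ≤_) eq h)
... | inj₂ eq = inj₂ (subst (o ≤_) eq h)

∣m-n∣∸∣n-o∣≤∣m-o∣ : ∀ m n o → ∣ m - n ∣ ∸ ∣ n - o ∣ ≤ ∣ m - o ∣
∣m-n∣∸∣n-o∣≤∣m-o∣ m n o = m≤n+o⇒m∸n≤o ∣ m - n ∣ ∣ n - o ∣ (begin
  ∣ m - n ∣             ≤⟨ ∣-∣-triangle m o n ⟩
  ∣ m - o ∣ + ∣ o - n ∣ ≡⟨ cong (∣ m - o ∣ +_) (∣-∣-comm o n) ⟩
  ∣ m - o ∣ + ∣ n - o ∣ ≡⟨ +-comm ∣ m - o ∣ ∣ n - o ∣ ⟩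
  ∣ n - o ∣ + ∣ m - o ∣ ∎)
  where open ≤-Reasoning

n≤[m⊔n]⊔o : ∀ m n o → n ≤ (m ⊔ n) ⊔ o
n≤[m⊔n]⊔o m n o = ≤-trans (m≤n⊔m m n) (m≤m⊔n (m ⊔ n) o)

minInf≤ : ∀ k m → minInf k m ≤ k
minInf≤ k nothing  = ≤-refl
minInf≤ k (just m) = m⊓n≤m k m

minInf-minM≤ˡ : ∀ k s m → minInf k (minM s m) ≤ s
minInf-minM≤ˡ k s nothing  = m⊓n≤n k s
minInf-minM≤ˡ k s (just m) = ≤-trans (m⊓n≤n k (s ⊓ m)) (m⊓n≤m s m)

minInf-minM≤ʳ : ∀ k s m → minInf k (minM s m) ≤ minInf k m
minInf-minM≤ʳ k s nothing  = m⊓n≤m k s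
minInf-minM≤ʳ k s (just m) = ⊓-monoʳ-≤ k (m⊓n≤n s m)

module _ {n : ℕ} (M : MetricSpace n) where
  open MetricSpace M

  _≟ₚ_ : DecidableEquality Carrier
  x ≟ₚ y with d x y ≟ 0
  ... | yes dxy≡0 = yes (d-eq x y dxy≡0)
  ... | no  dxy≢0 = no λ { refl → dxy≢0 (d-refl x) }

  open import Data.List.Membership.DecPropositional _≟ₚ_ using (_∈?_)

  d-reverse-triangle : ∀ x y z → ∣ d x z - d y z ∣ ≤ d x y
  d-reverse-triangle x y z with ∣m-n∣≡[m∸n]∨[n∸m] (d x z) (d y z)
  ... | inj₁ eq = subst (_≤ d x y) (sym eq) (m≤n+o⇒m∸n≤o (d x z) (d y z)
        (subst (d x z ≤_) (+-comm (d x y) (d y z)) (d-tri x y z)))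
  ... | inj₂ eq = subst (_≤ d x y) (sym eq) (m≤n+o⇒m∸n≤o (d y z) (d x z)
        (subst (d y z ≤_) (trans (+-comm (d y x) (d x z)) (cong (d x z +_) (d-sym y x)))
          (d-tri y x z)))

  +-≤-via-between : ∀ x y e c → d x c + d e c ≤ d x e → d x c + d y c ≤ d x e + d y e
  +-≤-via-between x y e c between = begin
    d x c + d y c           ≤⟨ +-monoʳ-≤ (d x c) (d-tri y e c) ⟩
    d x c + (d y e + d e c) ≡⟨ cong (d x c +_) (+-comm (d y e) (d e c)) ⟩
    d x c + (d e c + d y e) ≡⟨ +-assoc (d x c) (d e c) (d y e) ⟨
    d x c + d e c + d y e   ≤⟨ +-monoˡ-≤ (d y e) between ⟩
    d x e + d y e           ∎
    where open ≤-Reasoning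

  ∸-≤-via-between : ∀ p q e c → d q c + d e c ≤ d q e → d p e ∸ d q e ≤ ∣ d p c - d q c ∣
  ∸-≤-via-between p q e c between = begin
    d p e ∸ d q e             ≤⟨ ∸-monoʳ-≤ (d p e) between ⟩
    d p e ∸ (d q c + d e c)   ≡⟨ cong (d p e ∸_) (+-comm (d q c) (d e c)) ⟩
    d p e ∸ (d e c + d q c)   ≡⟨ ∸-+-assoc (d p e) (d e c) (d q c) ⟨
    d p e ∸ d e c ∸ d q c     ≤⟨ ∸-monoˡ-≤ (d q c) (m≤n+o⇒m∸n≤o (d p e) (d e c) pe≤ec+pc) ⟩
    d p c ∸ d q c             ≤⟨ m∸n≤∣m-n∣ (d p c) (d q c) ⟩
    ∣ d p c - d q c ∣         ∎
    where
      open ≤-Reasoning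
      pe≤ec+pc : d p e ≤ d e c + d p c
      pe≤ec+pc = subst (d p e ≤_) (trans (cong (d p c +_) (d-sym c e)) (+-comm (d p c) (d e c)))
                    (d-tri p c e)

  ∸-≤-via-far : ∀ p q e c → d p e ≤ ∣ d p c - d e c ∣ → d p e ∸ d q e ≤ ∣ d p c - d q c ∣
  ∸-≤-via-far p q e c far = begin
    d p e ∸ d q e                             ≤⟨ ∸-mono far ∣ec-qc∣≤qe ⟩
    ∣ d p c - d e c ∣ ∸ ∣ d e c - d q c ∣     ≤⟨ ∣m-n∣∸∣n-o∣≤∣m-o∣ (d p c) (d e c) (d q c) ⟩
    ∣ d p c - d q c ∣                         ∎
    where
      open ≤-Reasoning
      ∣ec-qc∣≤qe : ∣ d e c - d q c ∣ ≤ d q e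
      ∣ec-qc∣≤qe = subst (∣ d e c - d q c ∣ ≤_) (d-sym e q) (d-reverse-triangle e q c)

  mLow-comm : ∀ x y C → mLow M x y C ≡ mLow M y x C
  mLow-comm x y []      = refl
  mLow-comm x y (c ∷ C) = cong₂ minM (+-comm (d x c) (d y c)) (mLow-comm x y C)

  mUp-comm : ∀ x y C → mUp M x y C ≡ mUp M y x C
  mUp-comm x y []      = refl
  mUp-comm x y (c ∷ C) = cong₂ _⊔_ (∣-∣-comm (d x c) (d y c)) (mUp-comm x y C)

  mLow-attained : ∀ x y C →
    mLow M x y C ≡ nothing ⊎ ∃[ c ] c ∈ C × mLow M x y C ≡ just (d x c + d y c)
  mLow-attained x y []      = inj₁ refl
  mLow-attained x y (c ∷ C) with mLow M x y C | mLow-attained x y C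
  ... | nothing | _ = inj₂ (c , here refl , refl)
  ... | just m  | inj₂ (c′ , c′∈C , m≡) with ⊓-sel (d x c + d y c) m
  ...   | inj₁ eq = inj₂ (c , here refl , cong just eq)
  ...   | inj₂ eq = inj₂ (c′ , there c′∈C , cong just (trans eq (just-injective m≡)))

  mUp-attained : ∀ x y C → mUp M x y C ≡ 0 ⊎ ∃[ c ] c ∈ C × mUp M x y C ≡ ∣ d x c - d y c ∣
  mUp-attained x y []      = inj₁ refl
  mUp-attained x y (c ∷ C) with ⊔-sel ∣ d x c - d y c ∣ (mUp M x y C) | mUp-attained x y C
  ... | inj₁ eq | _                     = inj₂ (c , here refl , eq)
  ... | inj₂ eq | inj₁ m≡0              = inj₁ (trans eq m≡0)
  ... | inj₂ eq | inj₂ (c′ , c′∈C , m≡) = inj₂ (c′ , there c′∈C , trans eq m≡)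

  minInf-mLow≤ : ∀ k {x y C c} → c ∈ C → minInf k (mLow M x y C) ≤ d x c + d y c
  minInf-mLow≤ k {x} {y} {c ∷ C} (here refl) = minInf-minM≤ˡ k (d x c + d y c) (mLow M x y C)
  minInf-mLow≤ k {x} {y} {c ∷ C} (there c′∈C) =
    ≤-trans (minInf-minM≤ʳ k (d x c + d y c) (mLow M x y C)) (minInf-mLow≤ k c′∈C)

  ∣d-d∣≤mUp : ∀ {x y C c} → c ∈ C → ∣ d x c - d y c ∣ ≤ mUp M x y C
  ∣d-d∣≤mUp (here refl)  = m≤m⊔n _ _
  ∣d-d∣≤mUp (there c∈C) = ≤-trans (∣d-d∣≤mUp c∈C) (m≤n⊔m _ _)

  minInf-mLow≤⁻ : ∀ k x y C {v} → minInf k (mLow M x y C) ≤ v →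
    k ≤ v ⊎ ∃[ c ] c ∈ C × d x c + d y c ≤ v
  minInf-mLow≤⁻ k x y C {v} h with mLow-attained x y C
  ... | inj₁ eq = inj₁ (subst (λ m → minInf k m ≤ v) eq h)
  ... | inj₂ (c , c∈C , eq)
    with m⊓n≤o⇒m≤o⊎n≤o k (d x c + d y c) (subst (λ m → minInf k m ≤ v) eq h)
  ...   | inj₁ k≤v = inj₁ k≤v
  ...   | inj₂ s≤v = inj₂ (c , c∈C , s≤v)

  ≤⊔mUp⁻ : ∀ k x y C {v} → v ≤ k ⊔ mUp M x y C → v ≤ k ⊎ ∃[ c ] c ∈ C × v ≤ ∣ d x c - d y c ∣
  ≤⊔mUp⁻ k x y C {v} h with o≤m⊔n⇒o≤m⊎o≤n k (mUp M x y C) h | mUp-attained x y C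
  ... | inj₁ v≤k | _                   = inj₁ v≤k
  ... | inj₂ v≤m | inj₁ m≡0            = inj₁ (≤-trans (subst (v ≤_) m≡0 v≤m) z≤n)
  ... | inj₂ v≤m | inj₂ (c , c∈C , m≡) = inj₂ (c , c∈C , subst (v ≤_) m≡ v≤m)

  +-through : ∀ {k K x y e} C → K ≤ 2 * k →
    minInf k (mLow M x e C) ≤ d x e → minInf k (mLow M y e C) ≤ d y e →
    minInf K (mLow M x y C) ≤ d x e + d y e
  +-through {k} {K} {x} {y} {e} C K≤2k x-e y-e
    with minInf-mLow≤⁻ k x e C x-e | minInf-mLow≤⁻ k y e C y-e
  ... | inj₂ (c , c∈C , between) | _ =
    ≤-trans (minInf-mLow≤ K c∈C) (+-≤-via-between x y e c between)
  ... | inj₁ _ | inj₂ (c , c∈C , between) =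
    ≤-trans (minInf-mLow≤ K c∈C)
      (subst₂ _≤_ (+-comm (d y c) (d x c)) (+-comm (d y e) (d x e)) (+-≤-via-between y x e c between))
  ... | inj₁ k≤x-e | inj₁ k≤y-e = begin
    minInf K (mLow M x y C) ≤⟨ minInf≤ K (mLow M x y C) ⟩
    K                       ≤⟨ K≤2k ⟩
    2 * k                   ≡⟨ cong (k +_) (+-identityʳ k) ⟩
    k + k                   ≤⟨ +-mono-≤ k≤x-e k≤y-e ⟩
    d x e + d y e           ∎
    where open ≤-Reasoning

  ∸-through : ∀ {k₁ k₂ p q e} C →
    d p e ≤ k₂ ⊔ mUp M p e C → minInf k₁ (mLow M q e C) ≤ d q e →
    d p e ∸ d q e ≤ (k₂ ∸ k₁) ⊔ mUp M p q C
  ∸-through {k₁} {k₂} {p} {q} {e} C p-e q-e with ≤⊔mUp⁻ k₂ p e C p-e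
  ... | inj₂ (c , c∈C , far) =
    ≤-trans (∸-≤-via-far p q e c far) (≤-trans (∣d-d∣≤mUp c∈C) (m≤n⊔m _ _))
  ... | inj₁ p-e≤k₂ with minInf-mLow≤⁻ k₁ q e C q-e
  ...   | inj₁ k₁≤q-e = ≤-trans (∸-mono p-e≤k₂ k₁≤q-e) (m≤m⊔n _ _)
  ...   | inj₂ (c , c∈C , between) =
    ≤-trans (∸-≤-via-between p q e c between) (≤-trans (∣d-d∣≤mUp c∈C) (m≤n⊔m _ _))

  ∣-∣-through : ∀ {k₁ k₂ x y e} C →
    d x e ≤ k₂ ⊔ mUp M x e C → minInf k₁ (mLow M x e C) ≤ d x e →
    d y e ≤ k₂ ⊔ mUp M y e C → minInf k₁ (mLow M y e C) ≤ d y e →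
    ∣ d x e - d y e ∣ ≤ (k₂ ∸ k₁) ⊔ mUp M x y C
  ∣-∣-through {k₁} {k₂} {x} {y} {e} C x-e≤ x-e≥ y-e≤ y-e≥
    with ∣m-n∣≡[m∸n]∨[n∸m] (d x e) (d y e)
  ... | inj₁ eq = subst (_≤ (k₂ ∸ k₁) ⊔ mUp M x y C) (sym eq) (∸-through C x-e≤ y-e≥)
  ... | inj₂ eq = subst₂ _≤_ (sym eq) (cong ((k₂ ∸ k₁) ⊔_) (mUp-comm y x C)) (∸-through C y-e≤ x-e≥)

  AmalgamDistance : Subset M → Carrier → Carrier → Set
  AmalgamDistance D x y =
    (∃[ e ] e ∈ D × d x y ≡ d x e + d y e × d x y < nStar n) ⊎
    (∃[ e ] e ∈ D × d x y ≡ ∣ d x e - d y e ∣ × nStar n < d x y) ⊎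
    d x y ≡ nStar n

  free-amalgam-cases : ∀ {X Y D x y} → FreelyAmalgamated M X Y D →
    x ∈ X → x ∉ D → y ∈ Y → y ∉ D → AmalgamDistance D x y
  free-amalgam-cases {D = D} {x} {y} (_ , fa) x∈X x∉D y∈Y y∉D
    with fa x y x∈X x∉D y∈Y y∉D | mLow-attained x y D
  ... | short , long , middle | mLow≡ = from-mLow mLow≡
    where
      from-mUp : ¬ BelowInf (mLow M x y D) (nStar n) →
        (∃[ e ] e ∈ D × d x y ≡ ∣ d x e - d y e ∣ × nStar n < d x y) ⊎ d x y ≡ nStar n
      from-mUp notShort with nStar n <? mUp M x y D | mUp-attained x y D
      ... | no notLong | _ = inj₂ (middle notShort notLong)
      ... | yes isLong | inj₁ m≡0 = contradiction (subst (nStar n <_) m≡0 isLong) (λ ())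
      ... | yes isLong | inj₂ (e , e∈D , m≡) =
        inj₁ (e , e∈D , trans (long isLong) m≡ , subst (nStar n <_) (sym (long isLong)) isLong)

      from-mLow : mLow M x y D ≡ nothing ⊎ (∃[ e ] e ∈ D × mLow M x y D ≡ just (d x e + d y e)) →
        AmalgamDistance D x y
      from-mLow (inj₁ m≡nothing) =
        inj₂ (from-mUp (subst (λ m → ¬ BelowInf m (nStar n)) (sym m≡nothing) λ ()))
      from-mLow (inj₂ (e , e∈D , m≡)) with d x e + d y e <? nStar n
      ... | yes isShort = let d≡ = short _ m≡ isShort in
        inj₁ (e , e∈D , d≡ , subst (_< nStar n) (sym d≡) isShort)
      ... | no notShort = inj₂ (from-mUp (subst (λ m → ¬ BelowInf m (nStar n)) (sym m≡) notShort))

  amalgam-lower : ∀ {X Y D C x y K} → FreelyAmalgamated M X Y D →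
    x ∈ X → x ∉ D → y ∈ Y → y ∉ D → K ≤ nStar n →
    (∀ {e} → e ∈ D → minInf K (mLow M x y C) ≤ d x e + d y e) →
    minInf K (mLow M x y C) ≤ d x y
  amalgam-lower {C = C} {x} {y} {K} fa x∈X x∉D y∈Y y∉D K≤n* through
    with free-amalgam-cases fa x∈X x∉D y∈Y y∉D
  ... | inj₁ (e , e∈D , d≡ , _)        = subst (minInf K (mLow M x y C) ≤_) (sym d≡) (through e∈D)
  ... | inj₂ (inj₁ (_ , _ , _ , n*<d)) = ≤-trans (minInf≤ K (mLow M x y C)) (≤-trans K≤n* (<⇒≤ n*<d))
  ... | inj₂ (inj₂ d≡n*)               = ≤-trans (minInf≤ K (mLow M x y C)) (subst (K ≤_) (sym d≡n*) K≤n*)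

  amalgam-upper : ∀ {X Y D C x y L} → FreelyAmalgamated M X Y D →
    x ∈ X → x ∉ D → y ∈ Y → y ∉ D →
    (∀ {e} → e ∈ D → ∣ d x e - d y e ∣ ≤ L ⊔ mUp M x y C) →
    d x y ≤ (L ⊔ nStar n) ⊔ mUp M x y C
  amalgam-upper {C = C} {x} {y} {L} fa x∈X x∉D y∈Y y∉D through
    with free-amalgam-cases fa x∈X x∉D y∈Y y∉D
  ... | inj₁ (_ , _ , _ , d<n*)         = ≤-trans (<⇒≤ d<n*) (n≤[m⊔n]⊔o L (nStar n) _)
  ... | inj₂ (inj₁ (e , e∈D , d≡ , _)) =
    subst (_≤ (L ⊔ nStar n) ⊔ mUp M x y C) (sym d≡)
      (≤-trans (through e∈D) (⊔-monoˡ-≤ _ (m≤m⊔n L _)))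
  ... | inj₂ (inj₂ d≡n*)               =
    subst (_≤ (L ⊔ nStar n) ⊔ mUp M x y C) (sym d≡n*) (n≤[m⊔n]⊔o L (nStar n) _)

  InterEq-sym : ∀ {X Y C} → InterEq M X Y C → InterEq M Y X C
  InterEq-sym X∩Y z =
    (λ (z∈Y , z∈X) → proj₁ (X∩Y z) (z∈X , z∈Y)) , (λ z∈C → swap (proj₂ (X∩Y z) z∈C))

  InterEq-++ : ∀ {X Y Z C} → InterEq M X Z C → InterEq M Y Z C → InterEq M (X ++ Y) Z C
  InterEq-++ {X} X∩Z Y∩Z z =
    (λ (z∈X++Y , z∈Z) →
      [ (λ z∈X → proj₁ (X∩Z z) (z∈X , z∈Z)) , (λ z∈Y → proj₁ (Y∩Z z) (z∈Y , z∈Z)) ]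
        (∈-++⁻ X z∈X++Y)) ,
    (λ z∈C → let z∈X , z∈Z = proj₂ (X∩Z z) z∈C in ∈-++⁺ˡ z∈X , z∈Z)

  InterEq-amalgam : ∀ {A B C D} → InterEq M (A ++ D) (B ++ D) D → InterEq M A D C →
    All (_∈ A) C → All (_∈ B) C → InterEq M A B C
  InterEq-amalgam A∪D∩B∪D A∩D C⊆A C⊆B z =
    (λ (z∈A , z∈B) → proj₁ (A∩D z) (z∈A , proj₁ (A∪D∩B∪D z) (∈-++⁺ˡ z∈A , ∈-++⁺ˡ z∈B))) ,
    (λ z∈C → All.lookup C⊆A z∈C , All.lookup C⊆B z∈C)

  InterEq-∉ : ∀ {X D C x} → InterEq M X D C → x ∈ X → x ∉ C → x ∉ D
  InterEq-∉ X∩D x∈X x∉C x∈D = x∉C (proj₁ (X∩D _) (x∈X , x∈D))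

  DistGe-sym : ∀ {X Y C k} → DistGe M X Y C k → DistGe M Y X C k
  DistGe-sym {C = C} {k} (X∩Y , ge) = InterEq-sym X∩Y , λ y x y∈Y y∉C x∈X x∉C →
    subst₂ _≤_ (cong (minInf k) (mLow-comm x y C)) (d-sym x y) (ge x y x∈X x∉C y∈Y y∉C)

  DistLe-sym : ∀ {X Y C k} → DistLe M X Y C k → DistLe M Y X C k
  DistLe-sym {C = C} {k} (X∩Y , le) = InterEq-sym X∩Y , λ y x y∈Y y∉C x∈X x∉C →
    subst₂ _≤_ (d-sym x y) (cong (k ⊔_) (mUp-comm x y C)) (le x y x∈X x∉C y∈Y y∉C)

  DistGe-++ : ∀ {X Y Z C k} → DistGe M X Z C k → DistGe M Y Z C k → DistGe M (X ++ Y) Z C k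
  DistGe-++ {X} (X∩Z , geX) (Y∩Z , geY) = InterEq-++ X∩Z Y∩Z , λ x z x∈X++Y x∉C z∈Z z∉C →
    [ (λ x∈X → geX x z x∈X x∉C z∈Z z∉C) , (λ x∈Y → geY x z x∈Y x∉C z∈Z z∉C) ]
      (∈-++⁻ X x∈X++Y)

  DistLe-++ : ∀ {X Y Z C k} → DistLe M X Z C k → DistLe M Y Z C k → DistLe M (X ++ Y) Z C k
  DistLe-++ {X} (X∩Z , leX) (Y∩Z , leY) = InterEq-++ X∩Z Y∩Z , λ x z x∈X++Y x∉C z∈Z z∉C →
    [ (λ x∈X → leX x z x∈X x∉C z∈Z z∉C) , (λ x∈Y → leY x z x∈Y x∉C z∈Z z∉C) ]
      (∈-++⁻ X x∈X++Y)

  amalgam-DistGe : ∀ {A B C D k₁} → FreelyAmalgamated M (A ++ D) (B ++ D) D →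
    DistGe M A D C k₁ → DistGe M B D C k₁ → InterEq M A B C →
    DistGe M A B C (nStar n ⊓ (2 * k₁))
  amalgam-DistGe {A} {B} {C} {D} {k₁} fa (A∩D , geA) (B∩D , geB) A∩B = A∩B , bound
    where
      bound : ∀ x y → x ∈ A → x ∉ C → y ∈ B → y ∉ C →
        minInf (nStar n ⊓ (2 * k₁)) (mLow M x y C) ≤ d x y
      bound x y x∈A x∉C y∈B y∉C =
        amalgam-lower {C = C} fa
          (∈-++⁺ˡ x∈A) (InterEq-∉ A∩D x∈A x∉C) (∈-++⁺ˡ y∈B) (InterEq-∉ B∩D y∈B y∉C)
          (m⊓n≤m _ _) through
        where
          through : ∀ {e} → e ∈ D → minInf (nStar n ⊓ (2 * k₁)) (mLow M x y C) ≤ d x e + d y e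
          through {e} e∈D with e ∈? C
          ... | yes e∈C = minInf-mLow≤ _ e∈C
          ... | no  e∉C = +-through C (m⊓n≤n _ _)
                            (geA x e x∈A x∉C e∈D e∉C) (geB y e y∈B y∉C e∈D e∉C)

  amalgam-DistLe : ∀ {A B C D k₁ k₂} → FreelyAmalgamated M (A ++ D) (B ++ D) D →
    DistGe M A D C k₁ → DistLe M A D C k₂ → DistGe M B D C k₁ → DistLe M B D C k₂ →
    InterEq M A B C → DistLe M A B C ((k₂ ∸ k₁) ⊔ nStar n)
  amalgam-DistLe {A} {B} {C} {D} {k₁} {k₂} fa (A∩D , geA) (_ , leA) (B∩D , geB) (_ , leB) A∩B =
    A∩B , bound
    where
      bound : ∀ x y → x ∈ A → x ∉ C → y ∈ B → y ∉ C →
        d x y ≤ ((k₂ ∸ k₁) ⊔ nStar n) ⊔ mUp M x y C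
      bound x y x∈A x∉C y∈B y∉C =
        amalgam-upper {C = C} fa
          (∈-++⁺ˡ x∈A) (InterEq-∉ A∩D x∈A x∉C) (∈-++⁺ˡ y∈B) (InterEq-∉ B∩D y∈B y∉C) through
        where
          through : ∀ {e} → e ∈ D → ∣ d x e - d y e ∣ ≤ (k₂ ∸ k₁) ⊔ mUp M x y C
          through {e} e∈D with e ∈? C
          ... | yes e∈C = ≤-trans (∣d-d∣≤mUp e∈C) (m≤n⊔m _ _)
          ... | no  e∉C = ∣-∣-through C
                            (leA x e x∈A x∉C e∈D e∉C) (geA x e x∈A x∉C e∈D e∉C)
                            (leB y e y∈B y∉C e∈D e∉C) (geB y e y∈B y∉C e∈D e∉C)

lemma3p6 : (n : ℕ) → 1 ≤ n → (M : MetricSpace n) →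
    (k₁ k₂ : ℕ) → 1 ≤ k₁ → k₁ ≤ nStar n → nStar n ≤ k₂ → k₂ ≤ n →
    (A B C D : Subset M) →
    All (_∈ A) C → All (_∈ B) C → All (_∈ D) C →
    FreelyAmalgamated M (A ++ D) (B ++ D) D →
    DistGe M A D C k₁ → DistLe M A D C k₂ →
    DistGe M B D C k₁ → DistLe M B D C k₂ →
    (DistGe M A B C (nStar n ⊓ (2 * k₁)) × DistLe M A B C ((k₂ ∸ k₁) ⊔ nStar n)) ×
    (DistGe M D (A ++ B) C k₁ × DistLe M D (A ++ B) C k₂)
lemma3p6 n _ M k₁ k₂ _ _ _ _ A B C D C⊆A C⊆B _ fa geA leA geB leB =
  (amalgam-DistGe M fa geA geB A∩B , amalgam-DistLe M fa geA leA geB leB A∩B) ,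
  (DistGe-sym M (DistGe-++ M geA geB) , DistLe-sym M (DistLe-++ M leA leB))
  where
    A∩B : InterEq M A B C
    A∩B = InterEq-amalgam M (proj₁ fa) (proj₁ geA) C⊆A C⊆B
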